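{- Let $Q$ be a quiver on $[4]$ of type $\widetilde{A}_{2,2}$, where the underlying cycle is $1-2-4-3-1$, and let $G=\mathbb{Z}/2\mathbb{Z}$ act on $[4]$ via $\tau(1)=4$, $\tau(2)=3$, $\tau(3)=2$, $\tau(4)=1$. If $Q$ is $G$-invariant, then $Q$ is $G$-admissible.
   Context: A quiver on $[N]$ is a finite directed multigraph with vertex set $[N]$ without loops and directed $2$-cycles; its adjacency matrix has $b_{i,j}=$ #(arrows $i\to j$) $-$ #(arrows $j\to i$). Mutation $\mu_k$: $b'_{i,j}=-b_{i,j}$ if $k\in\{i,j\}$, else $b'_{i,j}=b_{i,j}+\frac{|b_{i,k}|b_{k,j}+b_{i,k}|b_{k,j}|}{2}$. $Q$ is of type $\widetilde{A}_{2,2}$ (with the given labeling) if it is mutation equivalent to an acyclic quiver with arrows along the edges $\{1,2\},\{2,4\},\{4,3\},\{3,1\}$ having two arrows in each direction around the cycle, e.g. $1\to2\to4$, $1\to3\to4$. For a group $G$ acting on $[N]$: $Q$ is $G$-invariant if $b_{g(i),g(j)}=b_{i,j}$ for all $i,j,g$; a $G$-invariant $Q$ is $G$-admissible if for all $i,i'$ in the same orbit, $b_{i,i'}=0$ and $b_{i,j}b_{i',j}\ge0$ for all $j$. -}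

module Defs where

open import Data.Nat using (ℕ)
import Data.Nat as ℕ
open import Data.Integer using (ℤ; +_; _+_; _-_; _*_; ∣_∣; _≤_; 0ℤ)
open import Data.Integer.DivMod using (_/ℕ_)
open import Data.Fin using (Fin; zero; suc)
open import Data.Fin.Patterns using (0F; 1F; 2F; 3F)
open import Data.List using (List; []; _∷_)
open import Data.Product using (Σ; _×_; ∃-syntax)
open import Data.Sum using (_⊎_)
open import Relation.Binary.PropositionalEquality using (_≡_)
open import Relation.Nullary using (Dec; yes; no)
open import Data.Fin using (_≟_)

-- Vertex set [4] = Fin 4, with vertex 1 ↦ 0F, 2 ↦ 1F, 3 ↦ 2F, 4 ↦ 3F.
V : Set
V = Fin 4

record Quiver : Set where
  field
    arrows   : V → V → ℕ
    noLoops  : ∀ i → arrows i i ≡ 0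
    no2cycle : ∀ i j → arrows i j ≡ 0 ⊎ arrows j i ≡ 0

Mat : Set
Mat = V → V → ℤ

adj : Quiver → Mat
adj Q i j = + Quiver.arrows Q i j - + Quiver.arrows Q j i

-- Mutation at k, with the formula from the paper
-- (the numerator is always even, so /ℕ 2 is exact division).
μ : V → Mat → Mat
μ k b i j with i ≟ k | j ≟ k
... | yes _ | _     = Data.Integer.-_ (b i j)
... | no _  | yes _ = Data.Integer.-_ (b i j)
... | no _  | no _  =
  b i j + ((+ ∣ b i k ∣ * b k j + b i k * + ∣ b k j ∣) /ℕ 2)

mutSeq : List V → Mat → Mat
mutSeq []       b = b
mutSeq (k ∷ ks) b = mutSeq ks (μ k b)

_≐_ : Mat → Mat → Set
b ≐ c = ∀ i j → b i j ≡ c i j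

-- Mutation equivalence (mutation is an involution, so this relation
-- is symmetric; a sequence from b to c suffices).
MutEquiv : Mat → Mat → Set
MutEquiv b c = Σ (List V) λ ks → mutSeq ks b ≐ c

isOne : ℤ → ℕ
isOne (+ 1) = 1
isOne _     = 0

data Unit± : ℤ → Set where
  pos : Unit± (+ 1)
  neg : Unit± (Data.Integer.-_ (+ 1))

-- The acyclic quivers of type Ã_{2,2} with the given labeling: exactly one
-- arrow along each edge of the cycle 1-2-4-3-1, no other arrows, and, going
-- around the cycle 1→2→4→3→1, exactly two arrows point in each direction.
AcyclicÃ22 : Mat → Set
AcyclicÃ22 b =
  ((∀ i j → b i j ≡ Data.Integer.-_ (b j i)) ×
   Unit± (b 0F 1F) × Unit± (b 1F 3F) × Unit± (b 3F 2F) × Unit± (b 2F 0F) ×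
   b 0F 3F ≡ 0ℤ × b 1F 2F ≡ 0ℤ) ×
  (isOne (b 0F 1F) ℕ.+ isOne (b 1F 3F) ℕ.+ isOne (b 3F 2F) ℕ.+ isOne (b 2F 0F) ≡ 2)

TypeÃ22 : Quiver → Set
TypeÃ22 Q = ∃[ a ] (AcyclicÃ22 a × MutEquiv a (adj Q))

τ : V → V
τ 0F = 3F
τ 1F = 2F
τ 2F = 1F
τ 3F = 0F

data G : Set where
  e t : G

act : G → V → V
act e i = i
act t i = τ i

Invariant : Quiver → Set
Invariant Q = ∀ (g : G) i j → adj Q (act g i) (act g j) ≡ adj Q i j

SameOrbit : V → V → Set
SameOrbit i i' = ∃[ g ] (act g i ≡ i')

Admissible : Quiver → Set
Admissible Q = ∀ i i' → SameOrbit i i' →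
  (adj Q i i' ≡ 0ℤ) × (∀ j → 0ℤ ≤ adj Q i j * adj Q i' j)

{-# OPTIONS --safe #-}
-- The labelled mutation class of Ã_{2,2} is finite: breadth-first search from
-- the six acyclic orientations of the cycle 1-2-4-3-1 closes up after 54
-- exchange matrices. Being in a mutation-closed list is preserved by every
-- mutation sequence, so adj Q is one of these 54 matrices; a direct check
-- shows that only two of them are τ-invariant, and both are τ-admissible.
module Submission where

open import Defs
open import Data.Product using (_×_; _,_)
open import Data.Nat as ℕ using (ℕ)
open import Data.Nat.Literals as ℕLit using ()
open import Data.Integer.Properties using (neg-involutive)
open import Data.Integer as ℤ using (ℤ; -_; _*_; _≤_; _≤?_; 0ℤ)
open import Data.Integer.Literals as ℤLit using ()
open import Data.Fin using (_≟_)
open import Data.Fin.Patterns using (0F; 1F; 2F; 3F)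
open import Data.Fin.Properties using (all?)
open import Data.List using (List; []; _∷_)
open import Data.List.Relation.Unary.All as All using (All)
open import Data.List.Relation.Unary.Any as Any using (Any)
open import Data.Unit using (tt)
open import Agda.Builtin.FromNat using (Number; fromNat)
open import Agda.Builtin.FromNeg using (Negative; fromNeg)
open import Relation.Binary.PropositionalEquality
  using (_≡_; refl; sym; trans; cong; cong₂; subst)
open import Relation.Nullary using (Dec; yes; no)
open import Relation.Nullary.Decidable using (True; toWitness; _×-dec_; _→-dec_)

instance
  ℕ-number : Number ℕ
  ℕ-number = ℕLit.number
  ℤ-number : Number ℤ
  ℤ-number = ℤLit.number
  ℤ-negative : Negative ℤ
  ℤ-negative = ℤLit.negative

≐-sym : ∀ {b c} → b ≐ c → c ≐ b
≐-sym b≐c i j = sym (b≐c i j)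

≐-trans : ∀ {b c d} → b ≐ c → c ≐ d → b ≐ d
≐-trans b≐c c≐d i j = trans (b≐c i j) (c≐d i j)

_≐?_ : (b c : Mat) → Dec (b ≐ c)
b ≐? c = all? λ i → all? λ j → b i j ℤ.≟ c i j

μ-cong : ∀ k {b c} → b ≐ c → μ k b ≐ μ k c
μ-cong k b≐c i j with i ≟ k | j ≟ k
... | yes _ | _     = cong -_ (b≐c i j)
... | no _  | yes _ = cong -_ (b≐c i j)
... | no _  | no _  = cong₂ ℤ._+_ (b≐c i j) (cong (ℤ._/ℕ 2)
  (cong₂ ℤ._+_ (cong₂ _*_ (cong (λ x → ℤ.+ ℤ.∣ x ∣) (b≐c i k)) (b≐c k j))
               (cong₂ _*_ (b≐c i k) (cong (λ x → ℤ.+ ℤ.∣ x ∣) (b≐c k j)))))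

infix 4 _∈ₘ_
_∈ₘ_ : Mat → List Mat → Set
b ∈ₘ cs = Any (b ≐_) cs

Respects≐ : (Mat → Set) → Set
Respects≐ P = ∀ {b c} → b ≐ c → P c → P b

All-∈ₘ : ∀ {P cs b} → Respects≐ P → All P cs → b ∈ₘ cs → P b
All-∈ₘ resp = All.lookupWith (λ pc b≐c → resp b≐c pc)

MutationClosed : List Mat → Set
MutationClosed cs = All (λ c → ∀ k → μ k c ∈ₘ cs) cs

μ-∈ₘ : ∀ {cs} → MutationClosed cs → ∀ k {b} → b ∈ₘ cs → μ k b ∈ₘ cs
μ-∈ₘ closed k = All-∈ₘ (λ b≐c μc∈ → Any.map (≐-trans (μ-cong k b≐c)) μc∈)
                       (All.map (λ μ∈ → μ∈ k) closed)

mutSeq-∈ₘ : ∀ {cs} → MutationClosed cs → ∀ ks {b} → b ∈ₘ cs → mutSeq ks b ∈ₘ cs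
mutSeq-∈ₘ closed []       b∈ = b∈
mutSeq-∈ₘ closed (k ∷ ks) b∈ = mutSeq-∈ₘ closed ks (μ-∈ₘ closed k b∈)

skew : ℤ → ℤ → ℤ → ℤ → ℤ → ℤ → Mat
skew u _ _ _ _ _ 0F 1F = u
skew _ v _ _ _ _ 0F 2F = v
skew _ _ w _ _ _ 0F 3F = w
skew _ _ _ x _ _ 1F 2F = x
skew _ _ _ _ y _ 1F 3F = y
skew _ _ _ _ _ z 2F 3F = z
skew u _ _ _ _ _ 1F 0F = - u
skew _ v _ _ _ _ 2F 0F = - v
skew _ _ w _ _ _ 3F 0F = - w
skew _ _ _ x _ _ 2F 1F = - x
skew _ _ _ _ y _ 3F 1F = - y
skew _ _ _ _ _ z 3F 2F = - z
skew _ _ _ _ _ _ _  _  = 0ℤ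

Ã22-class : List Mat
Ã22-class =
  skew 1 1 0 0 1 1 ∷
  skew 1 1 0 0 -1 -1 ∷
  skew 1 -1 0 0 -1 1 ∷
  skew -1 1 0 0 1 -1 ∷
  skew -1 -1 0 0 1 1 ∷
  skew -1 -1 0 0 -1 -1 ∷
  skew -1 1 1 0 -1 1 ∷
  skew 1 -1 1 0 1 -1 ∷
  skew -1 1 0 -1 -1 1 ∷
  skew 1 -1 0 -1 1 -1 ∷
  skew 1 -1 0 1 1 -1 ∷
  skew -1 1 0 1 -1 1 ∷
  skew 1 -1 -1 0 1 -1 ∷
  skew -1 1 -1 0 -1 1 ∷
  skew 1 -1 -1 1 0 1 ∷
  skew -1 -1 2 0 -1 -1 ∷
  skew 0 1 -1 -1 1 -1 ∷
  skew -1 1 -1 -1 1 0 ∷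
  skew 1 0 -1 1 -1 1 ∷
  skew 1 0 -1 1 1 1 ∷
  skew 0 -1 1 1 -1 -1 ∷
  skew -1 1 0 -2 1 -1 ∷
  skew -1 -1 1 1 -1 0 ∷
  skew 1 1 -1 1 0 1 ∷
  skew -1 0 1 -1 -1 -1 ∷
  skew 0 1 -1 -1 1 1 ∷
  skew 1 -1 0 2 -1 1 ∷
  skew 1 1 -1 -1 1 0 ∷
  skew -1 -1 1 -1 0 -1 ∷
  skew -1 1 1 -1 0 -1 ∷
  skew 1 1 -2 0 1 1 ∷
  skew 0 -1 1 1 -1 1 ∷
  skew 1 -1 1 1 -1 0 ∷
  skew -1 0 1 -1 1 -1 ∷
  skew -1 0 -1 -1 0 1 ∷
  skew 1 -2 1 1 0 -1 ∷
  skew 0 -1 1 -1 1 -2 ∷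
  skew 0 1 -1 1 -1 0 ∷
  skew 0 -1 -1 1 1 0 ∷
  skew -2 1 1 -1 -1 0 ∷
  skew -1 0 1 1 -2 1 ∷
  skew 1 0 -1 -1 0 -1 ∷
  skew -1 0 1 1 0 1 ∷
  skew 1 0 -1 -1 2 -1 ∷
  skew -1 2 -1 -1 0 1 ∷
  skew 1 0 1 1 0 -1 ∷
  skew 0 -1 1 -1 1 0 ∷
  skew 0 1 -1 1 -1 2 ∷
  skew 2 -1 -1 1 1 0 ∷
  skew 0 1 1 -1 -1 0 ∷
  skew 1 0 1 -1 0 1 ∷
  skew -1 0 -1 1 0 -1 ∷
  skew 0 -1 -1 -1 -1 0 ∷
  skew 0 1 1 1 1 0 ∷
  []

Ã22-class-closed : MutationClosed Ã22-class
Ã22-class-closed = toWitness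
  {a? = All.all? (λ c → all? λ k → Any.any? (μ k c ≐?_) Ã22-class) Ã22-class} tt

∈ₘ-Ã22-by-search : ∀ b → True (Any.any? (b ≐?_) Ã22-class) → b ∈ₘ Ã22-class
∈ₘ-Ã22-by-search _ = toWitness

-- The acyclic matrix with b₁₂ = x, b₂₄ = y, b₄₃ = z, b₃₁ = w.
cycle : ℤ → ℤ → ℤ → ℤ → Mat
cycle x y z w = skew x (- w) 0ℤ 0ℤ y (- z)

cycle-∈ₘ : ∀ {x y z w} → Unit± x → Unit± y → Unit± z → Unit± w →
  isOne x ℕ.+ isOne y ℕ.+ isOne z ℕ.+ isOne w ≡ 2 → cycle x y z w ∈ₘ Ã22-class
cycle-∈ₘ pos pos pos pos ()
cycle-∈ₘ pos pos pos neg ()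
cycle-∈ₘ pos pos neg pos ()
cycle-∈ₘ pos pos neg neg _ = ∈ₘ-Ã22-by-search _ tt
cycle-∈ₘ pos neg pos pos ()
cycle-∈ₘ pos neg pos neg _ = ∈ₘ-Ã22-by-search _ tt
cycle-∈ₘ pos neg neg pos _ = ∈ₘ-Ã22-by-search _ tt
cycle-∈ₘ pos neg neg neg ()
cycle-∈ₘ neg pos pos pos ()
cycle-∈ₘ neg pos pos neg _ = ∈ₘ-Ã22-by-search _ tt
cycle-∈ₘ neg pos neg pos _ = ∈ₘ-Ã22-by-search _ tt
cycle-∈ₘ neg pos neg neg ()
cycle-∈ₘ neg neg pos pos _ = ∈ₘ-Ã22-by-search _ tt
cycle-∈ₘ neg neg pos neg ()
cycle-∈ₘ neg neg neg pos ()
cycle-∈ₘ neg neg neg neg ()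

x≡-x⇒x≡0 : ∀ {x} → x ≡ - x → x ≡ 0ℤ
x≡-x⇒x≡0 {ℤ.+ 0} _ = refl

acyclic≐cycle : ∀ {a} → AcyclicÃ22 a → a ≐ cycle (a 0F 1F) (a 1F 3F) (a 3F 2F) (a 2F 0F)
acyclic≐cycle {a} ((skew-sym , _ , _ , _ , _ , a₁₄≡0 , a₂₃≡0) , _) = go
  where
  go : a ≐ cycle (a 0F 1F) (a 1F 3F) (a 3F 2F) (a 2F 0F)
  go 0F 0F = x≡-x⇒x≡0 (skew-sym 0F 0F)
  go 1F 1F = x≡-x⇒x≡0 (skew-sym 1F 1F)
  go 2F 2F = x≡-x⇒x≡0 (skew-sym 2F 2F)
  go 3F 3F = x≡-x⇒x≡0 (skew-sym 3F 3F)
  go 0F 1F = refl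
  go 1F 0F = skew-sym 1F 0F
  go 1F 3F = refl
  go 3F 1F = skew-sym 3F 1F
  go 3F 2F = sym (neg-involutive _)
  go 2F 3F = skew-sym 2F 3F
  go 2F 0F = sym (neg-involutive _)
  go 0F 2F = skew-sym 0F 2F
  go 0F 3F = a₁₄≡0
  go 3F 0F = trans (skew-sym 3F 0F) (cong -_ a₁₄≡0)
  go 1F 2F = a₂₃≡0
  go 2F 1F = trans (skew-sym 2F 1F) (cong -_ a₂₃≡0)

acyclic-∈ₘ : ∀ {a} → AcyclicÃ22 a → a ∈ₘ Ã22-class
acyclic-∈ₘ acyclic@((_ , x± , y± , z± , w± , _) , two) =
  Any.map (≐-trans (acyclic≐cycle acyclic)) (cycle-∈ₘ x± y± z± w± two)

InvariantMat : Mat → Set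
InvariantMat b = ∀ g i j → b (act g i) (act g j) ≡ b i j

OrbitCondition : Mat → V → V → Set
OrbitCondition b i i' = (b i i' ≡ 0ℤ) × (∀ j → 0ℤ ≤ b i j * b i' j)

AdmissibleMat : Mat → Set
AdmissibleMat b = ∀ i i' → SameOrbit i i' → OrbitCondition b i i'

OrbitConditions : Mat → Set
OrbitConditions b = ∀ g i → OrbitCondition b i (act g i)

admissible-by-orbits : ∀ {b} → OrbitConditions b → AdmissibleMat b
admissible-by-orbits conds i _ (g , refl) = conds g i

invariant-resp : ∀ {b c} → b ≐ c → InvariantMat b → InvariantMat c
invariant-resp b≐c inv g i j = trans (sym (b≐c _ _)) (trans (inv g i j) (b≐c i j))

orbitConditions-resp : Respects≐ OrbitConditions
orbitConditions-resp b≐c conds g i =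
  let c₀ , c≥ = conds g i in
  trans (b≐c _ _) c₀ ,
  λ j → subst (0ℤ ≤_) (sym (cong₂ _*_ (b≐c i j) (b≐c _ j))) (c≥ j)

∀G? : {P : G → Set} → (∀ g → Dec (P g)) → Dec (∀ g → P g)
∀G? P? with P? e | P? t
... | yes pe | yes pt = yes λ { e → pe ; t → pt }
... | no ¬pe | _      = no λ h → ¬pe (h e)
... | _      | no ¬pt = no λ h → ¬pt (h t)

invariant? : ∀ b → Dec (InvariantMat b)
invariant? b = ∀G? λ g → all? λ i → all? λ j → b (act g i) (act g j) ℤ.≟ b i j

orbitConditions? : ∀ b → Dec (OrbitConditions b)
orbitConditions? b = ∀G? λ g → all? λ i →
  (b i (act g i) ℤ.≟ 0ℤ) ×-dec all? λ j → 0ℤ ≤? b i j * b (act g i) j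

InvariantAdmissible : Mat → Set
InvariantAdmissible b = InvariantMat b → OrbitConditions b

invariantAdmissible-resp : Respects≐ InvariantAdmissible
invariantAdmissible-resp b≐c h inv =
  orbitConditions-resp b≐c (h (invariant-resp b≐c inv))

Ã22-class-invariantAdmissible : All InvariantAdmissible Ã22-class
Ã22-class-invariantAdmissible =
  toWitness {a? = All.all? (λ b → invariant? b →-dec orbitConditions? b) Ã22-class} tt

lemma4p8 : (Q : Quiver) → TypeÃ22 Q → Invariant Q → Invariant Q × Admissible Q
lemma4p8 Q (a , acyclic , ks , a↝Q) inv =
  inv , admissible-by-orbits (All-∈ₘ invariantAdmissible-resp Ã22-class-invariantAdmissible adjQ∈ inv)
  where
  adjQ∈ : adj Q ∈ₘ Ã22-class
  adjQ∈ = Any.map (≐-trans (≐-sym a↝Q))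
    (mutSeq-∈ₘ Ã22-class-closed ks (acyclic-∈ₘ acyclic))
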